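{- Let $b,n,c$ be positive integers with $4\leqslant 4b\leqslant n$. For every abelian group $\Gamma$ of order $4nbc$ there exists a diagonal $\mathrm{MRS}_\Gamma(n;4b;c)$.
   Context: For positive integers $m,n,s,k,c$ and an abelian group $\Gamma$ of order $nkc$, an $\mathrm{MRS}_\Gamma(m,n;s,k;c)$ is a set of $c$ partially filled $m\times n$ arrays (some cells may be empty) with entries in $\Gamma$ such that every element of $\Gamma$ appears exactly once and in a unique array; in every array each row has exactly $s$ filled cells and each column exactly $k$ filled cells; and there exist $\omega,\delta\in\Gamma$ such that in every array each row sums to $\omega$ and each column sums to $\delta$. $\mathrm{MRS}_\Gamma(n;k;c)$ denotes $\mathrm{MRS}_\Gamma(n,n;k,k;c)$. For an $n\times n$ array, the diagonal $D_\ell$ ($0\leqslant\ell\leqslant n-1$) is the set of cells $(i,j)$ with $j-i\equiv\ell\pmod n$. An $\mathrm{MRS}_\Gamma(n;k;c)$ is diagonal if, in every one of its arrays, the filled cells are exactly the cells of $k$ consecutive diagonals $D_t,D_{t+1},\ldots,D_{t+k-1}$ (indices modulo $n$). -}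

module Defs where

open import Level using (Level; _⊔_)
open import Data.Nat using (ℕ; zero; suc; _+_; _*_; _∸_; _<_; _≤_)
open import Data.Nat.DivMod using (_%_)
open import Data.Fin using (Fin; toℕ)
open import Data.Maybe using (Maybe; just; nothing; Is-just)
open import Data.Product using (Σ; ∃; ∃-syntax; _×_; _,_)
open import Function.Bundles using (_⇔_)
open import Relation.Binary.PropositionalEquality using (_≡_)
open import Algebra.Bundles using (AbelianGroup)

∑ : ∀ {a} {A : Set a} (_∙_ : A → A → A) (ε : A) (n : ℕ) → (Fin n → A) → A
∑ _∙_ ε zero    f = ε
∑ _∙_ ε (suc n) f = f Fin.zero ∙ ∑ _∙_ ε n (λ i → f (Fin.suc i))
  where import Data.Fin as Fin

countFilled : ∀ {a} {A : Set a} (n : ℕ) → (Fin n → Maybe A) → ℕ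
countFilled zero    f = 0
countFilled (suc n) f = filled (f Fin.zero) + countFilled n (λ i → f (Fin.suc i))
  where
    import Data.Fin as Fin
    filled : _ → ℕ
    filled (just _) = 1
    filled nothing  = 0

module _ {c ℓ : Level} (G : AbelianGroup c ℓ) where
  open AbelianGroup G renaming (Carrier to Γ)

  record HasOrder (N : ℕ) : Set (c ⊔ ℓ) where
    field
      enum      : Fin N → Γ
      enum-inj  : ∀ x y → enum x ≈ enum y → x ≡ y
      enum-surj : ∀ g → ∃[ x ] (enum x ≈ g)

  val : Maybe Γ → Γ
  val (just g) = g
  val nothing  = ε

  Arrays : (m n k : ℕ) → Set _
  Arrays m n k = Fin k → Fin m → Fin n → Maybe Γ

  record IsMRS (m n s k c' : ℕ) (A : Arrays m n c') : Set (c ⊔ ℓ) where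
    field
      appears  : ∀ g → ∃[ a ] ∃[ i ] ∃[ j ] Σ Γ λ x → (A a i j ≡ just x) × (x ≈ g)
      unique   : ∀ a i j a' i' j' x y → A a i j ≡ just x → A a' i' j' ≡ just y →
                 x ≈ y → (a ≡ a') × (i ≡ i') × (j ≡ j')
      rowCount : ∀ a i → countFilled n (λ j → A a i j) ≡ s
      colCount : ∀ a j → countFilled m (λ i → A a i j) ≡ k
      ω δ      : Γ
      rowSum   : ∀ a i → ∑ _∙_ ε n (λ j → val (A a i j)) ≈ ω
      colSum   : ∀ a j → ∑ _∙_ ε m (λ i → val (A a i j)) ≈ δ

  -- Index ℓ of the diagonal D_ℓ containing cell (i,j) of an n×n array:
  -- ℓ ≡ j - i (mod n), 0 ≤ ℓ < n.
  diagIndex : ∀ {n} → Fin n → Fin n → ℕ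
  diagIndex {zero}  i j = 0
  diagIndex {suc n} i j = (toℕ j + (suc n ∸ toℕ i)) % suc n

  InDiagonals : ∀ {n} (t : Fin n) (k : ℕ) → Fin n → Fin n → Set
  InDiagonals {zero}  t k i j = Data.Empty.⊥ where import Data.Empty
  InDiagonals {suc n} t k i j =
    ∃[ r ] (r < k × diagIndex i j ≡ (toℕ t + r) % suc n)

  record DiagonalMRS (n k c' : ℕ) : Set (c ⊔ ℓ) where
    field
      arrays   : Arrays n n c'
      isMRS    : IsMRS n n k k c' arrays
      diagonal : ∀ a → ∃[ t ] (∀ i j → Is-just (arrays a i j) ⇔ InDiagonals t k i j)

module Submission where

-- Write Γ additively.  If d is an involution and neither g nor h = g + d is a square, the Klein
-- four-group generated by p ↦ p + d and p ↦ g - p acts freely on Γ, so Γ splits into quadruples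
-- (h - p, p + d, p, g - p): entries 0,1 and entries 2,3 of a quadruple sum to g, entries 0,2 and
-- entries 1,3 sum to h.  Such g and d exist when 4 divides |Γ|.  Inversion pairs off the elements
-- of order > 2, so there is an involution; squaring is then not injective, so some g is not a
-- square; and if g + d were a square for every involution d, then the 2-torsion would be {0, d}
-- while the action for (0, d) splits the remaining elements into quadruples, forcing |Γ| ≡ 2 mod 4.
-- Each array fills the diagonals D₀, …, D₄ᵦ₋₁.  On the diagonals 4β, …, 4β+3, row i holds entries
-- 0,1 of the quadruple attached to row i - 2 and entries 2,3 of the quadruple attached to row i, so
-- every row meets two pairs summing to g and, thanks to the shift by 2, every column two pairs
-- summing to h.

open import Level using (Level; _⊔_)
open import Data.Nat using (ℕ; zero; suc; _+_; _*_; _∸_; _≤_; _<_; _<?_; z≤n; s≤s; NonZero)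
import Data.Nat.Properties as ℕₚ
open import Data.Nat.DivMod using (_%_; m%n<n; %-distribˡ-+; m%n%n≡m%n; [m+n]%n≡m%n; m<n⇒m%n≡m)
open import Data.Nat.Solver using (module +-*-Solver)
open import Data.Nat.Divisibility using (_∣_; divides; ∣m+n∣m⇒∣n; >⇒∤; ∣-trans)
open import Data.Fin using (Fin; toℕ; fromℕ<; combine; remQuot; punchOut)
import Data.Fin as Fin
open import Data.Fin.Patterns using (0F; 1F; 2F; 3F)
open import Data.Fin.Permutation using (Permutation; permutation; _⟨$⟩ʳ_)
open import Data.Fin.Properties
  using (toℕ-fromℕ<; toℕ-injective; toℕ<n; toℕ-combine; remQuot-combine; combine-remQuot;
         combine-injective; combine-surjective; injective⇒≤; punchOut-injective)
import Data.Fin.Properties as Finₚ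
open import Data.List using (List; []; _∷_; length; filter; tabulate; lookup; allFin)
open import Data.List.Properties using (filter-notAll; length-tabulate)
open import Data.List.Relation.Unary.All using (All; []; _∷_)
import Data.List.Relation.Unary.All as All
import Data.List.Relation.Unary.All.Properties as Allₚ
open import Data.List.Relation.Unary.Any using (here; there)
import Data.List.Relation.Unary.Any as Any
import Data.List.Relation.Unary.Any.Properties as Anyₚ
open import Data.List.Relation.Unary.AllPairs using ([]; _∷_)
open import Data.List.Relation.Unary.Unique.Propositional using (Unique)
import Data.List.Relation.Unary.Unique.Propositional.Properties as Uniqueₚ
open import Data.List.Membership.Propositional using (_∈_)
open import Data.List.Membership.Propositional.Properties
  using (∈-filter⁺; ∈-filter⁻; ∈-tabulate⁺; ∈-tabulate⁻; ∈-lookup; ∈-allFin)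
open import Data.List.Membership.Propositional.Properties.WithK using (unique∧set⇒bag)
open import Data.List.Relation.Binary.BagAndSetEquality using (∼bag⇒↭)
open import Data.List.Relation.Binary.Permutation.Propositional.Properties using (↭-length)
open import Data.Maybe using (Maybe; just; nothing; Is-just)
import Data.Maybe as Maybe
open import Data.Maybe.Relation.Unary.Any using (just)
open import Data.Product using (Σ; ∃-syntax; _×_; _,_; proj₁; proj₂; uncurry)
open import Data.Unit using (tt)
open import Data.Empty using (⊥-elim)
open import Function using (_∘_; id)
open import Function.Bundles using (_⇔_; mk⇔)
open import Function.Definitions using (Injective)
open import Relation.Nullary using (¬_; Dec; yes; no; contradiction)
open import Relation.Nullary.Decidable using (¬?; _×-dec_; decidable-stable; map′)
open import Relation.Unary using (Pred; Decidable)
open import Relation.Binary.Definitions using (DecidableEquality)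
import Relation.Binary.PropositionalEquality as ≡
open ≡ using (_≡_; _≢_)
open import Algebra.Bundles using (AbelianGroup; CommutativeMonoid)
open import Defs

module _ {a p} {A : Set a} {P : Pred A p} (P? : Decidable P) where

  length-filter+length-filter-∁ : ∀ xs →
    length (filter P? xs) + length (filter (¬? ∘ P?) xs) ≡ length xs
  length-filter+length-filter-∁ []       = ≡.refl
  length-filter+length-filter-∁ (x ∷ xs) with P? x
  ... | yes _ = ≡.cong suc (length-filter+length-filter-∁ xs)
  ... | no _  = ≡.trans (ℕₚ.+-suc _ _) (≡.cong suc (length-filter+length-filter-∁ xs))

module _ {a} {A : Set a} where

  unique-⇔⇒length-≡ : ∀ {xs ys : List A} → Unique xs → Unique ys →
                      (∀ {z} → z ∈ xs ⇔ z ∈ ys) → length xs ≡ length ys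
  unique-⇔⇒length-≡ uxs uys xs⇔ys = ↭-length (∼bag⇒↭ (unique∧set⇒bag uxs uys xs⇔ys))

  lookup-injective : ∀ {xs : List A} → Unique xs → ∀ i j → lookup xs i ≡ lookup xs j → i ≡ j
  lookup-injective (_ ∷ _)        Fin.zero    Fin.zero    _  = ≡.refl
  lookup-injective (x∉xs ∷ _)     Fin.zero    (Fin.suc j) eq = ⊥-elim (All.lookup x∉xs (∈-lookup j) eq)
  lookup-injective (x∉xs ∷ _)     (Fin.suc i) Fin.zero    eq = ⊥-elim (All.lookup x∉xs (∈-lookup i) (≡.sym eq))
  lookup-injective (_ ∷ unique)   (Fin.suc i) (Fin.suc j) eq = ≡.cong Fin.suc (lookup-injective unique i j eq)

injective⇒surjective : ∀ {n} {f : Fin n → Fin n} → Injective _≡_ _≡_ f → ∀ z → ∃[ w ] f w ≡ z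
injective⇒surjective {suc n} {f} f-injective z with Finₚ.any? (λ w → f w Finₚ.≟ z)
... | yes hit = hit
... | no miss = contradiction (injective⇒≤ punched-injective) ℕₚ.1+n≰n
  where
  punched : Fin (suc n) → Fin n
  punched w = punchOut {i = z} (λ z≡fw → miss (w , ≡.sym z≡fw))
  punched-injective : Injective _≡_ _≡_ punched
  punched-injective eq = f-injective (punchOut-injective {i = z} _ _ eq)

noninjective⇒nonsurjective : ∀ {n} (f : Fin n → Fin n) {x y} → f x ≡ f y → x ≢ y →
                             ∃[ z ] (∀ w → f w ≢ z)
noninjective⇒nonsurjective {n} f {x} {y} fx≡fy x≢y
  with Finₚ.any? (λ z → Finₚ.all? (λ w → ¬? (f w Finₚ.≟ z)))
... | yes missed = missed
... | no ¬missed = contradiction x≡y x≢y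
  where
  preimage : ∀ z → ∃[ w ] f w ≡ z
  preimage z with w , ¬fw≢z ← Finₚ.¬∀⟶∃¬ n _ (λ w → ¬? (f w Finₚ.≟ z)) (λ all → ¬missed (z , all))
    = w , decidable-stable (f w Finₚ.≟ z) ¬fw≢z
  section : Fin n → Fin n
  section z = proj₁ (preimage z)
  f∘section : ∀ z → f (section z) ≡ z
  f∘section z = proj₂ (preimage z)
  section-injective : Injective _≡_ _≡_ section
  section-injective {z} {z'} eq = ≡.trans (≡.sym (f∘section z)) (≡.trans (≡.cong f eq) (f∘section z'))
  x≡y : x ≡ y
  x≡y with u , ≡.refl ← injective⇒surjective section-injective x
         | v , ≡.refl ← injective⇒surjective section-injective y
    = ≡.cong section (≡.trans (≡.sym (f∘section u)) (≡.trans fx≡fy (f∘section v)))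

module Orbits {A : Set} (_≟_ : DecidableEquality A) {m : ℕ} (act : A → Fin m → A)
  (act-∘ : ∀ x ρ ρ' → ∃[ ρ'' ] act (act x ρ) ρ' ≡ act x ρ'')
  (act-undo : ∀ x ρ → ∃[ ρ' ] act (act x ρ) ρ' ≡ x)
  (act-id : ∀ x → ∃[ ρ ] act x ρ ≡ x)
  where

  SameOrbit : A → A → Set
  SameOrbit x y = ∃[ ρ ] act x ρ ≡ y

  sameOrbit? : ∀ x y → Dec (SameOrbit x y)
  sameOrbit? x y = Finₚ.any? (λ ρ → act x ρ ≟ y)

  sameOrbit-refl : ∀ x → SameOrbit x x
  sameOrbit-refl = act-id

  sameOrbit-sym : ∀ {x y} → SameOrbit x y → SameOrbit y x
  sameOrbit-sym {x} (ρ , ≡.refl) = act-undo x ρ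

  sameOrbit-trans : ∀ {x y z} → SameOrbit x y → SameOrbit y z → SameOrbit x z
  sameOrbit-trans {x} (ρ , ≡.refl) (ρ' , ≡.refl) = let ρ'' , eq = act-∘ x ρ ρ' in ρ'' , ≡.sym eq

  Free : A → Set
  Free x = ∀ ρ ρ' → act x ρ ≡ act x ρ' → ρ ≡ ρ'

  Closed : List A → Set
  Closed L = ∀ {x} → x ∈ L → ∀ ρ → act x ρ ∈ L

  orbit : A → List A
  orbit x = tabulate (act x)

  withoutOrbit : A → List A → List A
  withoutOrbit x = filter (¬? ∘ sameOrbit? x)

  record Transversal (L : List A) : Set where
    field
      reps          : List A
      reps-unique   : Unique reps
      reps⊆         : ∀ {r} → r ∈ reps → r ∈ L
      length≡reps*m : length L ≡ length reps * m
      covers        : ∀ {y} → y ∈ L → ∃[ r ] (r ∈ reps × SameOrbit r y)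
      disjoint      : ∀ {r r'} → r ∈ reps → r' ∈ reps → ∀ ρ ρ' → act r ρ ≡ act r' ρ' → r ≡ r'

  module _ {x L} (x∈L : x ∈ L) (x-free : Free x) (uL : Unique L) (closed : Closed L) where

    length-filter-sameOrbit : length (filter (sameOrbit? x) L) ≡ m
    length-filter-sameOrbit =
      ≡.trans (unique-⇔⇒length-≡ (Uniqueₚ.filter⁺ (sameOrbit? x) uL) (Uniqueₚ.tabulate⁺ (x-free _ _))
                                 (mk⇔ to from))
              (length-tabulate (act x))
      where
      to : ∀ {z} → z ∈ filter (sameOrbit? x) L → z ∈ orbit x
      to z∈ with ρ , ≡.refl ← proj₂ (∈-filter⁻ (sameOrbit? x) {xs = L} z∈) = ∈-tabulate⁺ ρ
      from : ∀ {z} → z ∈ orbit x → z ∈ filter (sameOrbit? x) L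
      from z∈ with ρ , ≡.refl ← ∈-tabulate⁻ z∈ = ∈-filter⁺ (sameOrbit? x) (closed x∈L ρ) (ρ , ≡.refl)

    withoutOrbit-closed : Closed (withoutOrbit x L)
    withoutOrbit-closed {z} z∈ ρ = let z∈L , x≁z = ∈-filter⁻ (¬? ∘ sameOrbit? x) z∈ in
      ∈-filter⁺ (¬? ∘ sameOrbit? x) (closed z∈L ρ) (λ x~ → x≁z (sameOrbit-trans x~ (act-undo z ρ)))

    consOrbit : Transversal (withoutOrbit x L) → Transversal L
    consOrbit T = record
      { reps          = x ∷ reps
      ; reps-unique   = All.tabulate (λ r∈ x≡r → x≁reps r∈ (≡.subst (SameOrbit x) x≡r (sameOrbit-refl x)))
                        ∷ reps-unique
      ; reps⊆         = λ { (here ≡.refl) → x∈L ; (there r∈) → proj₁ (∈-filter⁻ outside? (reps⊆ r∈)) }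
      ; length≡reps*m = ≡.trans (≡.sym (length-filter+length-filter-∁ (sameOrbit? x) L))
                                (≡.cong₂ _+_ length-filter-sameOrbit length≡reps*m)
      ; covers        = covers′
      ; disjoint      = disjoint′
      }
      where
      open Transversal T
      outside? = ¬? ∘ sameOrbit? x
      x≁reps : ∀ {r} → r ∈ reps → ¬ SameOrbit x r
      x≁reps r∈ = proj₂ (∈-filter⁻ outside? {xs = L} (reps⊆ r∈))
      covers′ : ∀ {y} → y ∈ L → ∃[ r ] (r ∈ x ∷ reps × SameOrbit r y)
      covers′ {y} y∈ with sameOrbit? x y
      ... | yes x~y = x , here ≡.refl , x~y
      ... | no x≁y  = let r , r∈ , r~y = covers (∈-filter⁺ outside? y∈ x≁y) in r , there r∈ , r~y
      disjoint′ : ∀ {r r'} → r ∈ x ∷ reps → r' ∈ x ∷ reps → ∀ ρ ρ' → act r ρ ≡ act r' ρ' → r ≡ r'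
      disjoint′ (here ≡.refl) (here ≡.refl) _ _ _ = ≡.refl
      disjoint′ (here ≡.refl) (there r'∈) ρ ρ' eq =
        ⊥-elim (x≁reps r'∈ (sameOrbit-trans (ρ , eq) (sameOrbit-sym (ρ' , ≡.refl))))
      disjoint′ (there r∈) (here ≡.refl) ρ ρ' eq =
        ⊥-elim (x≁reps r∈ (sameOrbit-trans (ρ' , ≡.sym eq) (sameOrbit-sym (ρ , ≡.refl))))
      disjoint′ (there r∈) (there r'∈) = disjoint r∈ r'∈

  transversal : ∀ L → Unique L → All Free L → Closed L → Transversal L
  transversal L = go (length L) L ℕₚ.≤-refl
    where
    go : ∀ fuel L → length L ≤ fuel → Unique L → All Free L → Closed L → Transversal L
    go _ [] _ _ _ _ = record
      { reps = [] ; reps-unique = [] ; reps⊆ = λ () ; length≡reps*m = ≡.refl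
      ; covers = λ () ; disjoint = λ () }
    go (suc fuel) L@(x ∷ _) (s≤s L'≤fuel) uL free closed =
      consOrbit x∈L (All.lookup free x∈L) uL closed
        (go fuel (withoutOrbit x L) (ℕₚ.≤-trans (ℕₚ.≤-pred shorter) L'≤fuel)
            (Uniqueₚ.filter⁺ (¬? ∘ sameOrbit? x) uL) (Allₚ.filter⁺ (¬? ∘ sameOrbit? x) free)
            (withoutOrbit-closed x∈L (All.lookup free x∈L) uL closed))
      where
      x∈L = here ≡.refl
      shorter : length (withoutOrbit x L) < length L
      shorter = filter-notAll (¬? ∘ sameOrbit? x) L (here (λ x≁x → x≁x (sameOrbit-refl x)))

  m∣length : ∀ L → Unique L → All Free L → Closed L → m ∣ length L
  m∣length L uL free closed = divides (length reps) length≡reps*m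
    where open Transversal (transversal L uL free closed)
infixl 7 _·_
_·_ : Fin 4 → Fin 4 → Fin 4
2F · ρ  = ρ
ρ  · 2F = ρ
0F · 0F = 2F
0F · 1F = 3F
0F · 3F = 1F
1F · 0F = 3F
1F · 1F = 2F
1F · 3F = 0F
3F · 0F = 1F
3F · 1F = 0F
3F · 3F = 2F

·-self : ∀ ρ → ρ · ρ ≡ 2F
·-self 0F = ≡.refl
·-self 1F = ≡.refl
·-self 2F = ≡.refl
·-self 3F = ≡.refl

·≡2F⇒≡ : ∀ ρ ρ' → ρ · ρ' ≡ 2F → ρ ≡ ρ'
·≡2F⇒≡ 0F 0F _ = ≡.refl
·≡2F⇒≡ 1F 1F _ = ≡.refl
·≡2F⇒≡ 2F 2F _ = ≡.refl
·≡2F⇒≡ 3F 3F _ = ≡.refl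
·≡2F⇒≡ 0F 1F ()
·≡2F⇒≡ 0F 2F ()
·≡2F⇒≡ 0F 3F ()
·≡2F⇒≡ 1F 0F ()
·≡2F⇒≡ 1F 2F ()
·≡2F⇒≡ 1F 3F ()
·≡2F⇒≡ 2F 0F ()
·≡2F⇒≡ 2F 1F ()
·≡2F⇒≡ 2F 3F ()
·≡2F⇒≡ 3F 0F ()
·≡2F⇒≡ 3F 1F ()
·≡2F⇒≡ 3F 2F ()

module KleinQuadruples {c ℓ : Level} (G : AbelianGroup c ℓ) where
  open AbelianGroup G renaming (Carrier to Γ)
  open import Algebra.Properties.AbelianGroup G
  open import Relation.Binary.Reasoning.Setoid setoid
  open import Algebra.Solver.CommutativeMonoid commutativeMonoid using (solve; _⊕_; _⊜_)

  xx⁻¹y≈y : ∀ x y → (x ∙ x ⁻¹) ∙ y ≈ y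
  xx⁻¹y≈y x y = trans (∙-congʳ (inverseʳ x)) (identityˡ y)

  x[yz⁻¹]⁻¹≈xy⁻¹z : ∀ x y z → x ∙ (y ∙ z ⁻¹) ⁻¹ ≈ (x ∙ y ⁻¹) ∙ z
  x[yz⁻¹]⁻¹≈xy⁻¹z x y z = begin
    x ∙ (y ∙ z ⁻¹) ⁻¹     ≈⟨ ∙-congˡ (⁻¹-∙-comm y (z ⁻¹)) ⟨
    x ∙ (y ⁻¹ ∙ z ⁻¹ ⁻¹)  ≈⟨ ∙-congˡ (∙-congˡ (⁻¹-involutive z)) ⟩
    x ∙ (y ⁻¹ ∙ z)        ≈⟨ assoc x (y ⁻¹) z ⟨
    (x ∙ y ⁻¹) ∙ z        ∎

  xy⁻¹≈y⇒x≈yy : ∀ {x y} → x ∙ y ⁻¹ ≈ y → x ≈ y ∙ y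
  xy⁻¹≈y⇒x≈yy {x} {y} eq = begin
    x               ≈⟨ identityʳ x ⟨
    x ∙ ε           ≈⟨ ∙-congˡ (inverseˡ y) ⟨
    x ∙ (y ⁻¹ ∙ y)  ≈⟨ assoc x (y ⁻¹) y ⟨
    (x ∙ y ⁻¹) ∙ y  ≈⟨ ∙-congʳ eq ⟩
    y ∙ y           ∎

  xyxy≈xxyy : ∀ x y → (x ∙ y) ∙ (x ∙ y) ≈ (x ∙ x) ∙ (y ∙ y)
  xyxy≈xxyy = solve 2 (λ x y → (x ⊕ y) ⊕ (x ⊕ y) ⊜ (x ⊕ x) ⊕ (y ⊕ y)) refl

  xy⁻¹xy⁻¹≈xx[yy]⁻¹ : ∀ x y → (x ∙ y ⁻¹) ∙ (x ∙ y ⁻¹) ≈ (x ∙ x) ∙ (y ∙ y) ⁻¹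
  xy⁻¹xy⁻¹≈xx[yy]⁻¹ x y = trans (xyxy≈xxyy x (y ⁻¹)) (∙-congˡ (⁻¹-∙-comm y y))

  x⁻¹≈ε⇒x≈ε : ∀ {x} → x ⁻¹ ≈ ε → x ≈ ε
  x⁻¹≈ε⇒x≈ε eq = ⁻¹-injective (trans eq (sym ε⁻¹≈ε))

  xx≈ε⇒xy⁻¹xy⁻¹≈ε⇒yy≈ε : ∀ {x y} → x ∙ x ≈ ε → (x ∙ y ⁻¹) ∙ (x ∙ y ⁻¹) ≈ ε → y ∙ y ≈ ε
  xx≈ε⇒xy⁻¹xy⁻¹≈ε⇒yy≈ε {x} {y} x²≈ε eq = x⁻¹≈ε⇒x≈ε (begin
    (y ∙ y) ⁻¹               ≈⟨ identityˡ _ ⟨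
    ε ∙ (y ∙ y) ⁻¹           ≈⟨ ∙-congʳ x²≈ε ⟨
    (x ∙ x) ∙ (y ∙ y) ⁻¹     ≈⟨ xy⁻¹xy⁻¹≈xx[yy]⁻¹ x y ⟨
    (x ∙ y ⁻¹) ∙ (x ∙ y ⁻¹)  ≈⟨ eq ⟩
    ε                        ∎)

  IsSquare : Γ → Set (c ⊔ ℓ)
  IsSquare a = ∃[ x ] (x ∙ x ≈ a)

  isSquare-resp : ∀ {a b} → a ≈ b → IsSquare a → IsSquare b
  isSquare-resp a≈b (x , x²≈a) = x , trans x²≈a a≈b

  isSquare-÷ : ∀ {a b} → IsSquare a → IsSquare b → IsSquare (a ∙ b ⁻¹)
  isSquare-÷ {a} {b} (x , x²≈a) (y , y²≈b) = x ∙ y ⁻¹ , (begin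
    (x ∙ y ⁻¹) ∙ (x ∙ y ⁻¹)  ≈⟨ xy⁻¹xy⁻¹≈xx[yy]⁻¹ x y ⟩
    (x ∙ x) ∙ (y ∙ y) ⁻¹     ≈⟨ ∙-cong x²≈a (⁻¹-cong y²≈b) ⟩
    a ∙ b ⁻¹                 ∎)

  Involution : Γ → Set ℓ
  Involution d = d ∙ d ≈ ε × ¬ d ≈ ε

  record QuadruplePartition (M : ℕ) : Set (c ⊔ ℓ) where
    field
      quadruple            : Fin M → Fin 4 → Γ
      quadruple-injective  : ∀ r ρ r' ρ' → quadruple r ρ ≈ quadruple r' ρ' → r ≡ r' × ρ ≡ ρ'
      quadruple-surjective : ∀ x → ∃[ r ] ∃[ ρ ] quadruple r ρ ≈ x
      rowPair colPair      : Γ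
      sum₀₁ : ∀ r → quadruple r 0F ∙ quadruple r 1F ≈ rowPair
      sum₂₃ : ∀ r → quadruple r 2F ∙ quadruple r 3F ≈ rowPair
      sum₀₂ : ∀ r → quadruple r 0F ∙ quadruple r 2F ≈ colPair
      sum₁₃ : ∀ r → quadruple r 1F ∙ quadruple r 3F ≈ colPair

  module Quadruples (g d : Γ) (d∙d≈ε : d ∙ d ≈ ε) where

    d⁻¹≈d : d ⁻¹ ≈ d
    d⁻¹≈d = sym (inverseʳ-unique d d d∙d≈ε)

    xdd≈x : ∀ x → (x ∙ d) ∙ d ≈ x
    xdd≈x x = trans (assoc x d d) (trans (∙-congˡ d∙d≈ε) (identityʳ x))

    h : Γ
    h = g ∙ d

    -- The orbit of p under the group generated by p ↦ p ∙ d and p ↦ g ∙ p ⁻¹.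
    quad : Γ → Fin 4 → Γ
    quad p 0F = h ∙ p ⁻¹
    quad p 1F = p ∙ d
    quad p 2F = p
    quad p 3F = g ∙ p ⁻¹

    quad-cong : ∀ {p q} → p ≈ q → ∀ ρ → quad p ρ ≈ quad q ρ
    quad-cong p≈q 0F = ∙-congˡ (⁻¹-cong p≈q)
    quad-cong p≈q 1F = ∙-congʳ p≈q
    quad-cong p≈q 2F = p≈q
    quad-cong p≈q 3F = ∙-congˡ (⁻¹-cong p≈q)

    x[yd]⁻¹≈xdy⁻¹ : ∀ x y → x ∙ (y ∙ d) ⁻¹ ≈ (x ∙ d) ∙ y ⁻¹
    x[yd]⁻¹≈xdy⁻¹ x y = begin
      x ∙ (y ∙ d) ⁻¹     ≈⟨ ∙-congˡ (⁻¹-∙-comm y d) ⟨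
      x ∙ (y ⁻¹ ∙ d ⁻¹)  ≈⟨ ∙-congˡ (∙-congˡ d⁻¹≈d) ⟩
      x ∙ (y ⁻¹ ∙ d)     ≈⟨ solve 3 (λ x y d → x ⊕ (y ⊕ d) ⊜ (x ⊕ d) ⊕ y) refl x (y ⁻¹) d ⟩
      (x ∙ d) ∙ y ⁻¹     ∎

    xy⁻¹d≈xdy⁻¹ : ∀ x y → (x ∙ y ⁻¹) ∙ d ≈ (x ∙ d) ∙ y ⁻¹
    xy⁻¹d≈xdy⁻¹ x y = solve 3 (λ x y d → (x ⊕ y) ⊕ d ⊜ (x ⊕ d) ⊕ y) refl x (y ⁻¹) d

    gh⁻¹≈d : g ∙ h ⁻¹ ≈ d
    gh⁻¹≈d = begin
      g ∙ (g ∙ d) ⁻¹     ≈⟨ ∙-congˡ (⁻¹-∙-comm g d) ⟨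
      g ∙ (g ⁻¹ ∙ d ⁻¹)  ≈⟨ assoc g (g ⁻¹) (d ⁻¹) ⟨
      (g ∙ g ⁻¹) ∙ d ⁻¹  ≈⟨ xx⁻¹y≈y g (d ⁻¹) ⟩
      d ⁻¹               ≈⟨ d⁻¹≈d ⟩
      d                  ∎

    hg⁻¹≈d : h ∙ g ⁻¹ ≈ d
    hg⁻¹≈d = xyx⁻¹≈y g d

    quad-· : ∀ p ρ ρ' → quad (quad p ρ) ρ' ≈ quad p (ρ · ρ')
    quad-· p 2F ρ  = refl
    quad-· p 0F 2F = refl
    quad-· p 1F 2F = refl
    quad-· p 3F 2F = refl
    quad-· p 0F 0F = trans (x[yz⁻¹]⁻¹≈xy⁻¹z h h p) (xx⁻¹y≈y h p)
    quad-· p 3F 3F = trans (x[yz⁻¹]⁻¹≈xy⁻¹z g g p) (xx⁻¹y≈y g p)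
    quad-· p 1F 1F = xdd≈x p
    quad-· p 0F 1F = trans (xy⁻¹d≈xdy⁻¹ h p) (∙-congʳ (xdd≈x g))
    quad-· p 1F 0F = trans (x[yd]⁻¹≈xdy⁻¹ h p) (∙-congʳ (xdd≈x g))
    quad-· p 3F 1F = xy⁻¹d≈xdy⁻¹ g p
    quad-· p 1F 3F = x[yd]⁻¹≈xdy⁻¹ g p
    quad-· p 0F 3F = trans (x[yz⁻¹]⁻¹≈xy⁻¹z g h p) (trans (∙-congʳ gh⁻¹≈d) (comm d p))
    quad-· p 3F 0F = trans (x[yz⁻¹]⁻¹≈xy⁻¹z h g p) (trans (∙-congʳ hg⁻¹≈d) (comm d p))

    module _ {p : Γ} (g≉pp : ¬ g ≈ p ∙ p) (h≉pp : ¬ h ≈ p ∙ p) (d≉ε : ¬ d ≈ ε) where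

      quad-free : ∀ ρ → quad p ρ ≈ p → ρ ≡ 2F
      quad-free 0F eq = ⊥-elim (h≉pp (xy⁻¹≈y⇒x≈yy eq))
      quad-free 1F eq = ⊥-elim (d≉ε (∙-cancelˡ p d ε (trans eq (sym (identityʳ p)))))
      quad-free 2F eq = ≡.refl
      quad-free 3F eq = ⊥-elim (g≉pp (xy⁻¹≈y⇒x≈yy eq))

      quad-injective : ∀ ρ ρ' → quad p ρ ≈ quad p ρ' → ρ ≡ ρ'
      quad-injective ρ ρ' eq = ≡.sym (·≡2F⇒≡ ρ' ρ (quad-free (ρ' · ρ) (begin
        quad p (ρ' · ρ)     ≈⟨ quad-· p ρ' ρ ⟨
        quad (quad p ρ') ρ  ≈⟨ quad-cong eq ρ ⟨
        quad (quad p ρ) ρ   ≈⟨ quad-· p ρ ρ ⟩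
        quad p (ρ · ρ)      ≡⟨ ≡.cong (quad p) (·-self ρ) ⟩
        p                   ∎)))

    quad-sum₀₁ : ∀ p → quad p 0F ∙ quad p 1F ≈ g
    quad-sum₀₁ p = begin
      (h ∙ p ⁻¹) ∙ (p ∙ d)
        ≈⟨ solve 4 (λ h p⁻¹ p d → (h ⊕ p⁻¹) ⊕ (p ⊕ d) ⊜ (p ⊕ p⁻¹) ⊕ (h ⊕ d)) refl h (p ⁻¹) p d ⟩
      (p ∙ p ⁻¹) ∙ (h ∙ d)  ≈⟨ xx⁻¹y≈y p (h ∙ d) ⟩
      h ∙ d                 ≈⟨ xdd≈x g ⟩
      g                     ∎

    quad-sum₂₃ : ∀ p → quad p 2F ∙ quad p 3F ≈ g
    quad-sum₂₃ p =
      trans (solve 3 (λ p g p⁻¹ → p ⊕ (g ⊕ p⁻¹) ⊜ (p ⊕ p⁻¹) ⊕ g) refl p g (p ⁻¹)) (xx⁻¹y≈y p g)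

    quad-sum₀₂ : ∀ p → quad p 0F ∙ quad p 2F ≈ h
    quad-sum₀₂ p =
      trans (solve 3 (λ h p⁻¹ p → (h ⊕ p⁻¹) ⊕ p ⊜ (p ⊕ p⁻¹) ⊕ h) refl h (p ⁻¹) p) (xx⁻¹y≈y p h)

    quad-sum₁₃ : ∀ p → quad p 1F ∙ quad p 3F ≈ h
    quad-sum₁₃ p =
      trans (solve 4 (λ p d g p⁻¹ → (p ⊕ d) ⊕ (g ⊕ p⁻¹) ⊜ (p ⊕ p⁻¹) ⊕ (g ⊕ d)) refl p d g (p ⁻¹))
            (xx⁻¹y≈y p h)

    quad-twoTorsion : g ∙ g ≈ ε → ∀ p ρ → quad p ρ ∙ quad p ρ ≈ ε → p ∙ p ≈ ε
    quad-twoTorsion g²≈ε p 0F =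
      xx≈ε⇒xy⁻¹xy⁻¹≈ε⇒yy≈ε (trans (xyxy≈xxyy g d) (trans (∙-cong g²≈ε d∙d≈ε) (identityˡ ε)))
    quad-twoTorsion g²≈ε p 1F eq =
      trans (sym (trans (∙-congˡ d∙d≈ε) (identityʳ _))) (trans (sym (xyxy≈xxyy p d)) eq)
    quad-twoTorsion g²≈ε p 2F eq = eq
    quad-twoTorsion g²≈ε p 3F = xx≈ε⇒xy⁻¹xy⁻¹≈ε⇒yy≈ε g²≈ε
module FiniteAbelianGroup {c ℓ : Level} (G : AbelianGroup c ℓ) {N : ℕ} (order : HasOrder G N) where
  open AbelianGroup G renaming (Carrier to Γ)
  open HasOrder order
  open import Algebra.Properties.AbelianGroup G
  open import Relation.Binary.Reasoning.Setoid setoid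
  open import Algebra.Solver.CommutativeMonoid commutativeMonoid using (solve; _⊕_; _⊜_)
  open KleinQuadruples G

  index : Γ → Fin N
  index x = proj₁ (enum-surj x)

  enum-index : ∀ x → enum (index x) ≈ x
  enum-index x = proj₂ (enum-surj x)

  index-cong : ∀ {x y} → x ≈ y → index x ≡ index y
  index-cong {x} {y} x≈y = enum-inj _ _ (trans (enum-index x) (trans x≈y (sym (enum-index y))))

  index-injective : ∀ {x y} → index x ≡ index y → x ≈ y
  index-injective {x} {y} eq = trans (sym (enum-index x)) (trans (reflexive (≡.cong enum eq)) (enum-index y))

  enum≈⇒≡index : ∀ {i x} → enum i ≈ x → i ≡ index x
  enum≈⇒≡index {i} eq = enum-inj _ _ (trans eq (sym (enum-index _)))

  square-index : ∀ x → enum (index x) ∙ enum (index x) ≈ x ∙ x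
  square-index x = ∙-cong (enum-index x) (enum-index x)

  infix 4 _≈?_
  _≈?_ : ∀ x y → Dec (x ≈ y)
  x ≈? y = map′ index-injective index-cong (index x Finₚ.≟ index y)

  isSquare? : ∀ a → Dec (IsSquare a)
  isSquare? a = map′ (λ (i , eq) → enum i , eq) (λ (x , eq) → index x , trans (square-index x) eq)
                     (Finₚ.any? (λ i → enum i ∙ enum i ≈? a))

  involution? : ∀ d → Dec (Involution d)
  involution? d = (d ∙ d ≈? ε) ×-dec ¬? (d ≈? ε)

  TwoTorsion : Fin N → Set ℓ
  TwoTorsion i = enum i ∙ enum i ≈ ε

  twoTorsion? : ∀ i → Dec (TwoTorsion i)
  twoTorsion? i = enum i ∙ enum i ≈? ε

  twoTorsion : List (Fin N)
  twoTorsion = filter twoTorsion? (allFin N)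

  nonTwoTorsion : List (Fin N)
  nonTwoTorsion = filter (¬? ∘ twoTorsion?) (allFin N)

  ∈-twoTorsion : ∀ {x} → x ∙ x ≈ ε → index x ∈ twoTorsion
  ∈-twoTorsion {x} x²≈ε = ∈-filter⁺ twoTorsion? (∈-allFin _) (trans (square-index x) x²≈ε)

  ∈-twoTorsion⁻ : ∀ {i} → i ∈ twoTorsion → TwoTorsion i
  ∈-twoTorsion⁻ i∈ = proj₂ (∈-filter⁻ twoTorsion? {xs = allFin N} i∈)

  unique-twoTorsion : Unique twoTorsion
  unique-twoTorsion = Uniqueₚ.filter⁺ twoTorsion? (Uniqueₚ.allFin⁺ N)

  length-nonTwoTorsion+length-twoTorsion : length nonTwoTorsion + length twoTorsion ≡ N
  length-nonTwoTorsion+length-twoTorsion = ≡.trans (ℕₚ.+-comm (length nonTwoTorsion) _)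
    (≡.trans (length-filter+length-filter-∁ twoTorsion? (allFin N)) (length-tabulate _))

  module IndexedOrbits {m : ℕ} (act : Γ → Fin m → Γ) (act-cong : ∀ {x y} → x ≈ y → ∀ ρ → act x ρ ≈ act y ρ)
    (_·_ : Fin m → Fin m → Fin m) (e : Fin m) (act-· : ∀ x ρ ρ' → act (act x ρ) ρ' ≈ act x (ρ · ρ'))
    (·-self : ∀ ρ → ρ · ρ ≡ e) (act-e : ∀ x → act x e ≈ x) where

    actᵢ : Fin N → Fin m → Fin N
    actᵢ i ρ = index (act (enum i) ρ)

    actᵢ-· : ∀ i ρ ρ' → actᵢ (actᵢ i ρ) ρ' ≡ actᵢ i (ρ · ρ')
    actᵢ-· i ρ ρ' = index-cong (trans (act-cong (enum-index _) ρ') (act-· (enum i) ρ ρ'))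

    actᵢ-e : ∀ i → actᵢ i e ≡ i
    actᵢ-e i = ≡.sym (enum≈⇒≡index (sym (act-e (enum i))))

    open Orbits Finₚ._≟_ actᵢ (λ i ρ ρ' → ρ · ρ' , actᵢ-· i ρ ρ')
      (λ i ρ → ρ , ≡.trans (actᵢ-· i ρ ρ) (≡.trans (≡.cong (actᵢ i) (·-self ρ)) (actᵢ-e i)))
      (λ i → e , actᵢ-e i) public

    free : ∀ {i} → (∀ ρ ρ' → act (enum i) ρ ≈ act (enum i) ρ' → ρ ≡ ρ') → Free i
    free injective ρ ρ' eq = injective ρ ρ' (index-injective eq)

    m∣length-nonTwoTorsion : (∀ x ρ → act x ρ ∙ act x ρ ≈ ε → x ∙ x ≈ ε) →
                             (∀ x → ¬ x ∙ x ≈ ε → ∀ ρ ρ' → act x ρ ≈ act x ρ' → ρ ≡ ρ') →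
                             m ∣ length nonTwoTorsion
    m∣length-nonTwoTorsion reflects injective =
      m∣length nonTwoTorsion (Uniqueₚ.filter⁺ _ (Uniqueₚ.allFin⁺ N))
        (All.tabulate (λ i∈ → free (injective _ (nonTwoTorsion⁻ i∈)))) closed
      where
      nonTwoTorsion⁻ : ∀ {i} → i ∈ nonTwoTorsion → ¬ TwoTorsion i
      nonTwoTorsion⁻ i∈ = proj₂ (∈-filter⁻ (¬? ∘ twoTorsion?) {xs = allFin N} i∈)
      closed : Closed nonTwoTorsion
      closed {i} i∈ ρ = ∈-filter⁺ (¬? ∘ twoTorsion?) (∈-allFin _) λ twoTorsion →
        nonTwoTorsion⁻ i∈ (reflects (enum i) ρ (trans (sym (square-index _)) twoTorsion))

  invert : Γ → Fin 2 → Γ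
  invert x 0F = x
  invert x 1F = x ⁻¹

  invert-cong : ∀ {x y} → x ≈ y → ∀ ρ → invert x ρ ≈ invert y ρ
  invert-cong x≈y 0F = x≈y
  invert-cong x≈y 1F = ⁻¹-cong x≈y

  _⊻_ : Fin 2 → Fin 2 → Fin 2
  0F ⊻ ρ  = ρ
  1F ⊻ 0F = 1F
  1F ⊻ 1F = 0F

  ⊻-self : ∀ ρ → ρ ⊻ ρ ≡ 0F
  ⊻-self 0F = ≡.refl
  ⊻-self 1F = ≡.refl

  invert-⊻ : ∀ x ρ ρ' → invert (invert x ρ) ρ' ≈ invert x (ρ ⊻ ρ')
  invert-⊻ x 0F ρ  = refl
  invert-⊻ x 1F 0F = refl
  invert-⊻ x 1F 1F = ⁻¹-involutive x

  module Inversion = IndexedOrbits invert invert-cong _⊻_ 0F invert-⊻ ⊻-self (λ _ → refl)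

  module KleinOrbits (g d : Γ) (d²≈ε : d ∙ d ≈ ε) = IndexedOrbits
    (Quadruples.quad g d d²≈ε) (Quadruples.quad-cong g d d²≈ε) _·_ 2F (Quadruples.quad-· g d d²≈ε) ·-self
    (λ _ → refl)

  ∃-involution : 2 ∣ N → ∃[ d ] Involution d
  ∃-involution 2∣N with Finₚ.any? (involution? ∘ enum)
  ... | yes (i , i-involution) = enum i , i-involution
  ... | no none = ⊥-elim (>⇒∤ (s≤s (s≤s z≤n)) 2∣1)
    where
    only-ε : ∀ {i} → i ∈ twoTorsion → i ∈ index ε ∷ []
    only-ε {i} i∈ with enum i ≈? ε
    ... | yes i≈ε = here (enum≈⇒≡index i≈ε)
    ... | no i≉ε  = ⊥-elim (none (i , ∈-twoTorsion⁻ i∈ , i≉ε))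
    ε-twoTorsion : ∀ {i} → i ∈ index ε ∷ [] → i ∈ twoTorsion
    ε-twoTorsion (here ≡.refl) = ∈-twoTorsion (identityˡ ε)
    length-twoTorsion : length twoTorsion ≡ 1
    length-twoTorsion = unique-⇔⇒length-≡ unique-twoTorsion ([] ∷ []) (mk⇔ only-ε ε-twoTorsion)
    inverse-reflects : ∀ x ρ → invert x ρ ∙ invert x ρ ≈ ε → x ∙ x ≈ ε
    inverse-reflects x 0F eq = eq
    inverse-reflects x 1F eq = x⁻¹≈ε⇒x≈ε (trans (sym (⁻¹-∙-comm x x)) eq)
    inverse-injective : ∀ x → ¬ x ∙ x ≈ ε → ∀ ρ ρ' → invert x ρ ≈ invert x ρ' → ρ ≡ ρ'
    inverse-injective x x²≉ε 0F 0F _  = ≡.refl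
    inverse-injective x x²≉ε 0F 1F eq = ⊥-elim (x²≉ε (trans (∙-congˡ eq) (inverseʳ x)))
    inverse-injective x x²≉ε 1F 0F eq = ⊥-elim (x²≉ε (trans (∙-congˡ (sym eq)) (inverseʳ x)))
    inverse-injective x x²≉ε 1F 1F _  = ≡.refl
    2∣1 : 2 ∣ 1
    2∣1 = ≡.subst (2 ∣_) length-twoTorsion
      (∣m+n∣m⇒∣n (≡.subst (2 ∣_) (≡.sym length-nonTwoTorsion+length-twoTorsion) 2∣N)
                 (Inversion.m∣length-nonTwoTorsion inverse-reflects inverse-injective))

  squareᵢ : Fin N → Fin N
  squareᵢ i = index (enum i ∙ enum i)

  ∃-nonSquare : ∃[ d ] Involution d → ∃[ g ] ¬ IsSquare g
  ∃-nonSquare (d , d²≈ε , d≉ε) =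
    let z , missed = noninjective⇒nonsurjective squareᵢ {index d} {index ε} squareᵢ-d≡squareᵢ-ε
                                                (d≉ε ∘ index-injective)
    in enum z , λ (x , x²≈z) → missed (index x) (≡.sym (enum≈⇒≡index (sym (trans (square-index x) x²≈z))))
    where
    squareᵢ-d≡squareᵢ-ε : squareᵢ (index d) ≡ squareᵢ (index ε)
    squareᵢ-d≡squareᵢ-ε =
      index-cong (trans (square-index d) (trans d²≈ε (sym (trans (square-index ε) (identityˡ ε)))))

  module _ {g : Γ} (g-nonSquare : ¬ IsSquare g)
           (g∙involution-square : ∀ {d} → Involution d → IsSquare (g ∙ d)) where

    involution-nonSquare : ∀ {d} → Involution d → ¬ IsSquare d
    involution-nonSquare {d} d-involution d-square =
      g-nonSquare (isSquare-resp (xyx⁻¹≈y d g) (isSquare-resp (∙-congʳ (comm g d))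
        (isSquare-÷ (g∙involution-square d-involution) d-square)))

    involution-unique : ∀ {d d'} → Involution d → Involution d' → d ≈ d'
    involution-unique {d} {d'} d-involution@(d²≈ε , _) d'-involution@(d'²≈ε , _) =
      x∙y⁻¹≈ε⇒x≈y d d' (decidable-stable (d ∙ d' ⁻¹ ≈? ε) λ u≉ε → involution-nonSquare (u²≈ε , u≉ε) u-square)
      where
      u²≈ε : (d ∙ d' ⁻¹) ∙ (d ∙ d' ⁻¹) ≈ ε
      u²≈ε = trans (xy⁻¹xy⁻¹≈xx[yy]⁻¹ d d') (trans (∙-cong d²≈ε (trans (⁻¹-cong d'²≈ε) ε⁻¹≈ε)) (identityˡ ε))
      u-square : IsSquare (d ∙ d' ⁻¹)
      u-square = isSquare-resp (begin
        (g ∙ d) ∙ (g ∙ d') ⁻¹     ≈⟨ ∙-congˡ (⁻¹-∙-comm g d') ⟨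
        (g ∙ d) ∙ (g ⁻¹ ∙ d' ⁻¹)
          ≈⟨ solve 4 (λ g d g⁻¹ d'⁻¹ → (g ⊕ d) ⊕ (g⁻¹ ⊕ d'⁻¹) ⊜ (g ⊕ g⁻¹) ⊕ (d ⊕ d'⁻¹)) refl g d (g ⁻¹) (d' ⁻¹) ⟩
        (g ∙ g ⁻¹) ∙ (d ∙ d' ⁻¹)  ≈⟨ xx⁻¹y≈y g _ ⟩
        d ∙ d' ⁻¹                 ∎)
        (isSquare-÷ (g∙involution-square d-involution) (g∙involution-square d'-involution))

    4∤N : ∃[ d ] Involution d → ¬ 4 ∣ N
    4∤N (d , d-involution@(d²≈ε , d≉ε)) 4∣N = >⇒∤ (s≤s (s≤s (s≤s z≤n))) 4∣2
      where
      ε-or-d : ∀ {i} → i ∈ twoTorsion → i ∈ index ε ∷ index d ∷ []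
      ε-or-d {i} i∈ with enum i ≈? ε
      ... | yes i≈ε = here (enum≈⇒≡index i≈ε)
      ... | no i≉ε  = there (here (enum≈⇒≡index (involution-unique (∈-twoTorsion⁻ i∈ , i≉ε) d-involution)))
      ε-d-twoTorsion : ∀ {i} → i ∈ index ε ∷ index d ∷ [] → i ∈ twoTorsion
      ε-d-twoTorsion (here ≡.refl)         = ∈-twoTorsion (identityˡ ε)
      ε-d-twoTorsion (there (here ≡.refl)) = ∈-twoTorsion d²≈ε
      ε≢d : index ε ≢ index d
      ε≢d = d≉ε ∘ sym ∘ index-injective
      length-twoTorsion : length twoTorsion ≡ 2
      length-twoTorsion =
        unique-⇔⇒length-≡ unique-twoTorsion ((ε≢d ∷ []) ∷ [] ∷ []) (mk⇔ ε-or-d ε-d-twoTorsion)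
      open Quadruples ε d d²≈ε
      4∣nonTwoTorsion : 4 ∣ length nonTwoTorsion
      4∣nonTwoTorsion = KleinOrbits.m∣length-nonTwoTorsion ε d d²≈ε (quad-twoTorsion (identityˡ ε))
        (λ p p²≉ε → quad-injective (p²≉ε ∘ sym)
                      (λ h≈p² → involution-nonSquare d-involution (p , trans (sym h≈p²) (identityˡ d))) d≉ε)
      4∣2 : 4 ∣ 2
      4∣2 = ≡.subst (4 ∣_) length-twoTorsion
        (∣m+n∣m⇒∣n (≡.subst (4 ∣_) (≡.sym length-nonTwoTorsion+length-twoTorsion) 4∣N) 4∣nonTwoTorsion)

  record KleinPair : Set (c ⊔ ℓ) where
    field
      g d           : Γ
      d-involution  : Involution d
      g-nonSquare   : ¬ IsSquare g
      g∙d-nonSquare : ¬ IsSquare (g ∙ d)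

  kleinPair : 4 ∣ N → KleinPair
  kleinPair 4∣N = extend (∃-nonSquare d₀)
    where
    d₀ = ∃-involution (∣-trans (divides 2 ≡.refl) 4∣N)
    extend : ∃[ g ] ¬ IsSquare g → KleinPair
    extend (g , g-nonSquare) with Finₚ.any? (λ i → involution? (enum i) ×-dec ¬? (isSquare? (g ∙ enum i)))
    ... | yes (i , i-involution , g∙i-nonSquare) = record
      { g = g ; d = enum i ; d-involution = i-involution
      ; g-nonSquare = g-nonSquare ; g∙d-nonSquare = g∙i-nonSquare }
    ... | no none = ⊥-elim (4∤N g-nonSquare g∙involution-square d₀ 4∣N)
      where
      g∙involution-square : ∀ {d} → Involution d → IsSquare (g ∙ d)
      g∙involution-square {d} (d²≈ε , d≉ε) = isSquare-resp (∙-congˡ (enum-index d))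
        (decidable-stable (isSquare? _) λ nonSquare →
          none (index d , (trans (square-index d) d²≈ε , d≉ε ∘ trans (sym (enum-index d))) , nonSquare))

  module _ (kp : KleinPair) where
    open KleinPair kp
    open KleinOrbits g d (proj₁ d-involution)
    open Quadruples g d (proj₁ d-involution)

    quad-injective-everywhere : ∀ p ρ ρ' → quad p ρ ≈ quad p ρ' → ρ ≡ ρ'
    quad-injective-everywhere p = quad-injective (λ g≈p² → g-nonSquare (p , sym g≈p²))
                                    (λ h≈p² → g∙d-nonSquare (p , sym h≈p²)) (proj₂ d-involution)

    transversalPartition : (T : Transversal (allFin N)) → QuadruplePartition (length (Transversal.reps T))
    transversalPartition T = record
      { quadruple            = λ r → quad (rep r)
      ; quadruple-injective  = injective
      ; quadruple-surjective = surjective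
      ; rowPair              = g
      ; colPair              = h
      ; sum₀₁                = λ r → quad-sum₀₁ (rep r)
      ; sum₂₃                = λ r → quad-sum₂₃ (rep r)
      ; sum₀₂                = λ r → quad-sum₀₂ (rep r)
      ; sum₁₃                = λ r → quad-sum₁₃ (rep r)
      }
      where
      open Transversal T
      rep : Fin (length reps) → Γ
      rep r = enum (lookup reps r)
      injective : ∀ r ρ r' ρ' → quad (rep r) ρ ≈ quad (rep r') ρ' → r ≡ r' × ρ ≡ ρ'
      injective r ρ r' ρ' eq
        with ≡.refl ← lookup-injective reps-unique r r'
                        (disjoint (∈-lookup r) (∈-lookup r') ρ ρ' (index-cong eq))
        = ≡.refl , quad-injective-everywhere (rep r) ρ ρ' eq
      surjective : ∀ x → ∃[ r ] ∃[ ρ ] quad (rep r) ρ ≈ x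
      surjective x with a , a∈ , ρ , actᵢaρ≡x ← covers (∈-allFin (index x)) = Any.index a∈ , ρ , (begin
        quad (rep (Any.index a∈)) ρ  ≈⟨ quad-cong (reflexive (≡.cong enum (Anyₚ.lookup-index a∈))) ρ ⟨
        quad (enum a) ρ              ≈⟨ enum-index _ ⟨
        enum (actᵢ a ρ)              ≡⟨ ≡.cong enum actᵢaρ≡x ⟩
        enum (index x)               ≈⟨ enum-index x ⟩
        x                            ∎)

    quadruplePartition : ∀ M → N ≡ M * 4 → QuadruplePartition M
    quadruplePartition M N≡M*4 = ≡.subst QuadruplePartition length-reps≡M (transversalPartition T)
      where
      T = transversal (allFin N) (Uniqueₚ.allFin⁺ N) (All.tabulate (λ _ → free (quad-injective-everywhere _)))
                      (λ _ _ → ∈-allFin _)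
      length-reps≡M : length (Transversal.reps T) ≡ M
      length-reps≡M = ℕₚ.*-cancelʳ-≡ _ M 4
        (≡.trans (≡.sym (Transversal.length≡reps*m T)) (≡.trans (length-tabulate _) N≡M*4))
module Cyclic (n : ℕ) .{{_ : NonZero n}} where
  open ≡.≡-Reasoning

  infixl 6 _+ₙ_ _-ₙ_ _⊖_

  _+ₙ_ : Fin n → ℕ → Fin n
  i +ₙ a = fromℕ< (m%n<n (toℕ i + a) n)

  _-ₙ_ : Fin n → ℕ → Fin n
  i -ₙ a = i +ₙ (n ∸ a)

  _⊖_ : Fin n → Fin n → Fin n
  j ⊖ i = j -ₙ toℕ i

  toℕ-+ₙ : ∀ i a → toℕ (i +ₙ a) ≡ (toℕ i + a) % n
  toℕ-+ₙ i a = toℕ-fromℕ< _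

  [m%n+k]%n≡[m+k]%n : ∀ m k → (m % n + k) % n ≡ (m + k) % n
  [m%n+k]%n≡[m+k]%n m k = begin
    (m % n + k) % n          ≡⟨ %-distribˡ-+ (m % n) k n ⟩
    (m % n % n + k % n) % n  ≡⟨ ≡.cong (λ x → (x + k % n) % n) (m%n%n≡m%n m n) ⟩
    (m % n + k % n) % n      ≡⟨ %-distribˡ-+ m k n ⟨
    (m + k) % n              ∎

  +ₙ-+ₙ : ∀ i a b → i +ₙ a +ₙ b ≡ i +ₙ (a + b)
  +ₙ-+ₙ i a b = toℕ-injective (begin
    toℕ (i +ₙ a +ₙ b)          ≡⟨ toℕ-+ₙ (i +ₙ a) b ⟩
    (toℕ (i +ₙ a) + b) % n     ≡⟨ ≡.cong (λ x → (x + b) % n) (toℕ-+ₙ i a) ⟩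
    ((toℕ i + a) % n + b) % n  ≡⟨ [m%n+k]%n≡[m+k]%n (toℕ i + a) b ⟩
    (toℕ i + a + b) % n        ≡⟨ ≡.cong (_% n) (ℕₚ.+-assoc (toℕ i) a b) ⟩
    (toℕ i + (a + b)) % n      ≡⟨ toℕ-+ₙ i (a + b) ⟨
    toℕ (i +ₙ (a + b))         ∎)

  +ₙ-n : ∀ i → i +ₙ n ≡ i
  +ₙ-n i = toℕ-injective (begin
    toℕ (i +ₙ n)       ≡⟨ toℕ-+ₙ i n ⟩
    (toℕ i + n) % n    ≡⟨ [m+n]%n≡m%n (toℕ i) n ⟩
    toℕ i % n          ≡⟨ m<n⇒m%n≡m (toℕ<n i) ⟩
    toℕ i              ∎)

  +ₙ-comm : ∀ i j → i +ₙ toℕ j ≡ j +ₙ toℕ i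
  +ₙ-comm i j = toℕ-injective (begin
    toℕ (i +ₙ toℕ j)       ≡⟨ toℕ-+ₙ i (toℕ j) ⟩
    (toℕ i + toℕ j) % n    ≡⟨ ≡.cong (_% n) (ℕₚ.+-comm (toℕ i) (toℕ j)) ⟩
    (toℕ j + toℕ i) % n    ≡⟨ toℕ-+ₙ j (toℕ i) ⟨
    toℕ (j +ₙ toℕ i)       ∎)

  -ₙ-+ₙ : ∀ i {a} → a ≤ n → i -ₙ a +ₙ a ≡ i
  -ₙ-+ₙ i {a} a≤n = ≡.trans (+ₙ-+ₙ i (n ∸ a) a) (≡.trans (≡.cong (i +ₙ_) (ℕₚ.m∸n+n≡m a≤n)) (+ₙ-n i))

  +ₙ--ₙ : ∀ i {a} → a ≤ n → i +ₙ a -ₙ a ≡ i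
  +ₙ--ₙ i {a} a≤n = ≡.trans (+ₙ-+ₙ i a (n ∸ a)) (≡.trans (≡.cong (i +ₙ_) (ℕₚ.m+[n∸m]≡n a≤n)) (+ₙ-n i))

  +ₙ-cancelʳ : ∀ {i j a} → a ≤ n → i +ₙ a ≡ j +ₙ a → i ≡ j
  +ₙ-cancelʳ {i} {j} {a} a≤n eq = ≡.trans (≡.sym (+ₙ--ₙ i a≤n)) (≡.trans (≡.cong (_-ₙ a) eq) (+ₙ--ₙ j a≤n))

  -ₙ--ₙ : ∀ i {a b} → a + b ≤ n → i -ₙ a -ₙ b ≡ i -ₙ (a + b)
  -ₙ--ₙ i {a} {b} a+b≤n = +ₙ-cancelʳ a+b≤n (begin
    i -ₙ a -ₙ b +ₙ (a + b)   ≡⟨ ≡.cong (i -ₙ a -ₙ b +ₙ_) (ℕₚ.+-comm a b) ⟩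
    i -ₙ a -ₙ b +ₙ (b + a)   ≡⟨ +ₙ-+ₙ (i -ₙ a -ₙ b) b a ⟨
    i -ₙ a -ₙ b +ₙ b +ₙ a    ≡⟨ ≡.cong (_+ₙ a) (-ₙ-+ₙ (i -ₙ a) (ℕₚ.m+n≤o⇒n≤o a a+b≤n)) ⟩
    i -ₙ a +ₙ a              ≡⟨ -ₙ-+ₙ i (ℕₚ.m+n≤o⇒m≤o a a+b≤n) ⟩
    i                        ≡⟨ -ₙ-+ₙ i a+b≤n ⟨
    i -ₙ (a + b) +ₙ (a + b)  ∎)

  +ₙ-⊖ : ∀ i j → i +ₙ toℕ (j ⊖ i) ≡ j
  +ₙ-⊖ i j = ≡.trans (+ₙ-comm i (j ⊖ i)) (-ₙ-+ₙ j (ℕₚ.<⇒≤ (toℕ<n i)))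

  -ₙ-⊖ : ∀ i j → j -ₙ toℕ (j ⊖ i) ≡ i
  -ₙ-⊖ i j = ≡.trans (≡.cong (_-ₙ toℕ (j ⊖ i)) (≡.sym (+ₙ-⊖ i j))) (+ₙ--ₙ i (ℕₚ.<⇒≤ (toℕ<n (j ⊖ i))))

  toℕ-+ₙ-⊖ : ∀ i {a} → a < n → toℕ (i +ₙ a ⊖ i) ≡ a
  toℕ-+ₙ-⊖ i {a} a<n = begin
    toℕ (i +ₙ a ⊖ i)            ≡⟨ ≡.cong (λ x → toℕ (i +ₙ x ⊖ i)) (toℕ-fromℕ< a<n) ⟨
    toℕ (i +ₙ toℕ a′ ⊖ i)       ≡⟨ ≡.cong (λ x → toℕ (x ⊖ i)) (+ₙ-comm i a′) ⟩
    toℕ (a′ +ₙ toℕ i -ₙ toℕ i)  ≡⟨ ≡.cong toℕ (+ₙ--ₙ a′ (ℕₚ.<⇒≤ (toℕ<n i))) ⟩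
    toℕ a′                      ≡⟨ toℕ-fromℕ< a<n ⟩
    a                           ∎
    where a′ = fromℕ< a<n

  toℕ-⊖--ₙ : ∀ j {a} → a < n → toℕ (j ⊖ (j -ₙ a)) ≡ a
  toℕ-⊖--ₙ j {a} a<n = ≡.trans (≡.cong (λ x → toℕ (x ⊖ (j -ₙ a))) (≡.sym (-ₙ-+ₙ j (ℕₚ.<⇒≤ a<n))))
                                (toℕ-+ₙ-⊖ (j -ₙ a) a<n)

module Sums {c ℓ : Level} (M : CommutativeMonoid c ℓ) where
  open CommutativeMonoid M renaming (Carrier to A)
  open import Relation.Binary.Reasoning.Setoid setoid
  import Algebra.Properties.CommutativeMonoid.Sum M as Sum

  ∑′ : (n : ℕ) → (Fin n → A) → A
  ∑′ = ∑ _∙_ ε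

  ∑′≡sum : ∀ n f → ∑′ n f ≡ Sum.sum f
  ∑′≡sum zero    f = ≡.refl
  ∑′≡sum (suc n) f = ≡.cong (f Fin.zero ∙_) (∑′≡sum n (f ∘ Fin.suc))

  ∑′-permute : ∀ n f (π : Permutation n n) → ∑′ n f ≈ ∑′ n (f ∘ (π ⟨$⟩ʳ_))
  ∑′-permute n f π = begin
    ∑′ n f                    ≡⟨ ∑′≡sum n f ⟩
    Sum.sum f                 ≈⟨ Sum.sum-permute f π ⟩
    Sum.sum (f ∘ (π ⟨$⟩ʳ_))   ≡⟨ ∑′≡sum n _ ⟨
    ∑′ n (f ∘ (π ⟨$⟩ʳ_))      ∎

  ∑′-cong : ∀ n {f g} → (∀ i → f i ≈ g i) → ∑′ n f ≈ ∑′ n g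
  ∑′-cong zero    f≈g = refl
  ∑′-cong (suc n) f≈g = ∙-cong (f≈g Fin.zero) (∑′-cong n (f≈g ∘ Fin.suc))

  ∑′-zero : ∀ n {f} → (∀ i → f i ≈ ε) → ∑′ n f ≈ ε
  ∑′-zero zero    f≈ε = refl
  ∑′-zero (suc n) f≈ε = trans (∙-cong (f≈ε Fin.zero) (∑′-zero n (f≈ε ∘ Fin.suc))) (identityˡ ε)

  ∑′-+ : ∀ m n (F : ℕ → A) → ∑′ (m + n) (F ∘ toℕ) ≈ ∑′ m (F ∘ toℕ) ∙ ∑′ n (λ i → F (m + toℕ i))
  ∑′-+ zero    n F = sym (identityˡ _)
  ∑′-+ (suc m) n F = trans (∙-congˡ (∑′-+ m n (F ∘ suc))) (sym (assoc _ _ _))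

  ∑′-blocks : ∀ b s n (F : ℕ → A) → b * s ≤ n → (∀ ℓ → b * s ≤ ℓ → F ℓ ≈ ε) →
              ∑′ n (F ∘ toℕ) ≈ ∑′ b (λ β → ∑′ s (λ ρ → F (toℕ β * s + toℕ ρ)))
  ∑′-blocks zero    s n F _ F≈ε = ∑′-zero n (λ ℓ → F≈ε (toℕ ℓ) z≤n)
  ∑′-blocks (suc b) s n F bs≤n F≈ε
    with o , ≡.refl ← ℕₚ.m≤n⇒∃[o]m+o≡n (ℕₚ.≤-trans (ℕₚ.m≤m+n s (b * s)) bs≤n) = begin
    ∑′ (s + o) (F ∘ toℕ)
      ≈⟨ ∑′-+ s o F ⟩
    ∑′ s (F ∘ toℕ) ∙ ∑′ o (λ i → F (s + toℕ i))
      ≈⟨ ∙-congˡ (∑′-blocks b s o (F ∘ (s +_)) (ℕₚ.+-cancelˡ-≤ s _ _ bs≤n)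
                   (λ ℓ bs≤ℓ → F≈ε (s + ℓ) (ℕₚ.+-monoʳ-≤ s bs≤ℓ))) ⟩
    ∑′ s (F ∘ toℕ) ∙ ∑′ b (λ β → ∑′ s (λ ρ → F (s + (toℕ β * s + toℕ ρ))))
      ≈⟨ ∙-congˡ (∑′-cong b (λ β → ∑′-cong s (λ ρ → reflexive (≡.cong F (≡.sym (ℕₚ.+-assoc s _ _)))))) ⟩
    ∑′ (suc b) (λ β → ∑′ s (λ ρ → F (toℕ β * s + toℕ ρ)))
      ∎

module Blocks (b s : ℕ) where

  offset : Fin b → Fin s → ℕ
  offset β ρ = toℕ β * s + toℕ ρ

  offset≡toℕ-combine : ∀ β ρ → offset β ρ ≡ toℕ (combine β ρ)
  offset≡toℕ-combine β ρ = ≡.trans (≡.cong (_+ toℕ ρ) (ℕₚ.*-comm (toℕ β) s)) (≡.sym (toℕ-combine β ρ))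

  offset< : ∀ β ρ → offset β ρ < b * s
  offset< β ρ = ℕₚ.≤-trans (ℕₚ.≤-reflexive (≡.cong suc (offset≡toℕ-combine β ρ))) (toℕ<n (combine β ρ))

  block : ℕ → Maybe (Fin b × Fin s)
  block ℓ with ℓ <? b * s
  ... | yes ℓ<bs = just (remQuot s (fromℕ< ℓ<bs))
  ... | no _     = nothing

  block-offset : ∀ β ρ → block (offset β ρ) ≡ just (β , ρ)
  block-offset β ρ with offset β ρ <? b * s
  ... | yes ℓ<bs = ≡.cong just (≡.trans (≡.cong (remQuot s) fromℕ<≡combine) (remQuot-combine β ρ))
    where fromℕ<≡combine = toℕ-injective (≡.trans (toℕ-fromℕ< ℓ<bs) (offset≡toℕ-combine β ρ))
  ... | no ℓ≮bs  = contradiction (offset< β ρ) ℓ≮bs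

  block-beyond : ∀ {ℓ} → b * s ≤ ℓ → block ℓ ≡ nothing
  block-beyond {ℓ} bs≤ℓ with ℓ <? b * s
  ... | yes ℓ<bs = contradiction bs≤ℓ (ℕₚ.<⇒≱ ℓ<bs)
  ... | no _     = ≡.refl

  block-within : ∀ {ℓ} → ℓ < b * s → Is-just (block ℓ)
  block-within {ℓ} ℓ<bs with ℓ <? b * s
  ... | yes _    = just tt
  ... | no ℓ≮bs  = contradiction ℓ<bs ℓ≮bs

  block≡just⇒offset : ∀ ℓ {β ρ} → block ℓ ≡ just (β , ρ) → ℓ ≡ offset β ρ
  block≡just⇒offset ℓ eq with ℓ <? b * s
  block≡just⇒offset ℓ ≡.refl | yes ℓ<bs = begin
    ℓ                                        ≡⟨ toℕ-fromℕ< ℓ<bs ⟨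
    toℕ i                                    ≡⟨ ≡.cong toℕ (combine-remQuot {b} s i) ⟨
    toℕ (uncurry combine (remQuot {b} s i))  ≡⟨ uncurry offset≡toℕ-combine (remQuot {b} s i) ⟨
    uncurry offset (remQuot {b} s i)         ∎
    where
    open ≡.≡-Reasoning
    i = fromℕ< ℓ<bs

filled : ∀ {a} {A : Set a} → Maybe A → ℕ
filled (just _) = 1
filled nothing  = 0

countFilled≡∑ : ∀ {a} {A : Set a} n (f : Fin n → Maybe A) → countFilled n f ≡ ∑ _+_ 0 n (filled ∘ f)
countFilled≡∑ zero    f = ≡.refl
countFilled≡∑ (suc n) f with f Fin.zero
... | just _  = ≡.cong suc (countFilled≡∑ n (f ∘ Fin.suc))
... | nothing = countFilled≡∑ n (f ∘ Fin.suc)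

∑-const : ∀ m c → ∑ _+_ 0 m (λ _ → c) ≡ m * c
∑-const zero    c = ≡.refl
∑-const (suc m) c = ≡.cong (c +_) (∑-const m c)

module Construction {c ℓ : Level} (G : AbelianGroup c ℓ) (b n' k : ℕ) (b*4≤n : b * 4 ≤ suc n')
                    (P : KleinQuadruples.QuadruplePartition G (k * (b * suc n'))) where

  n : ℕ
  n = suc n'

  open AbelianGroup G using () renaming (Carrier to Γ)
  open KleinQuadruples.QuadruplePartition P
  open Cyclic n
  open Blocks b 4

  diagIndex≡toℕ-⊖ : ∀ i j → diagIndex G i j ≡ toℕ (j ⊖ i)
  diagIndex≡toℕ-⊖ i j = ≡.sym (toℕ-+ₙ j _)

  rowPermutation : Fin n → Permutation n n
  rowPermutation i = permutation (λ ℓ → i +ₙ toℕ ℓ) (_⊖ i) (+ₙ-⊖ i)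
    (λ ℓ → toℕ-injective (toℕ-+ₙ-⊖ i (toℕ<n ℓ)))

  columnPermutation : Fin n → Permutation n n
  columnPermutation j = permutation (λ ℓ → j -ₙ toℕ ℓ) (j ⊖_) (λ i → -ₙ-⊖ i j)
    (λ ℓ → toℕ-injective (toℕ-⊖--ₙ j (toℕ<n ℓ)))

  quadrupleIndex : Fin k → Fin b → Fin n → Fin (k * (b * n))
  quadrupleIndex a β x = combine a (combine β x)

  -- Entries 0,1 in row i come from the quadruple of row i - 2, so in every column the diagonals
  -- 4β and 4β + 2 (and likewise 4β + 1 and 4β + 3) use the same quadruple.
  base : Fin n → Fin 4 → Fin n
  base i 0F = i -ₙ 2
  base i 1F = i -ₙ 2
  base i 2F = i
  base i 3F = i

  entry : Fin k → Fin n → Fin b × Fin 4 → Γ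
  entry a i (β , ρ) = quadruple (quadrupleIndex a β (base i ρ)) ρ

  onDiagonal : Fin k → Fin n → ℕ → Maybe Γ
  onDiagonal a i ℓ = Maybe.map (entry a i) (block ℓ)

  arrays : Arrays G n n k
  arrays a i j = onDiagonal a i (diagIndex G i j)

  arrays-+ₙ : ∀ a i {ℓ} → ℓ < n → arrays a i (i +ₙ ℓ) ≡ onDiagonal a i ℓ
  arrays-+ₙ a i {ℓ} ℓ<n =
    ≡.cong (onDiagonal a i) (≡.trans (diagIndex≡toℕ-⊖ i (i +ₙ ℓ)) (toℕ-+ₙ-⊖ i ℓ<n))

  arrays--ₙ : ∀ a j {ℓ} → ℓ < n → arrays a (j -ₙ ℓ) j ≡ onDiagonal a (j -ₙ ℓ) ℓ
  arrays--ₙ a j {ℓ} ℓ<n =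
    ≡.cong (onDiagonal a (j -ₙ ℓ)) (≡.trans (diagIndex≡toℕ-⊖ (j -ₙ ℓ) j) (toℕ-⊖--ₙ j ℓ<n))

  offset<n : ∀ β ρ → offset β ρ < n
  offset<n β ρ = ℕₚ.<-≤-trans (offset< β ρ) b*4≤n

  module LineSums {c′ ℓ′ : Level} (M : CommutativeMonoid c′ ℓ′) (φ : Maybe Γ → CommutativeMonoid.Carrier M)
                  (φ-nothing : CommutativeMonoid._≈_ M (φ nothing) (CommutativeMonoid.ε M)) where
    open CommutativeMonoid M using (_≈_; trans; reflexive) renaming (ε to 0#)
    open Sums M

    ∑-diagonals : ∀ a (row : ℕ → Fin n) →
                  ∑′ n (λ ℓ → φ (onDiagonal a (row (toℕ ℓ)) (toℕ ℓ))) ≈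
                  ∑′ b (λ β → ∑′ 4 (λ ρ → φ (just (entry a (row (offset β ρ)) (β , ρ)))))
    ∑-diagonals a row = trans (∑′-blocks b 4 n (λ ℓ → φ (onDiagonal a (row ℓ) ℓ)) b*4≤n vanish)
      (∑′-cong b λ β → ∑′-cong 4 λ ρ →
        reflexive (≡.cong (φ ∘ Maybe.map (entry a (row (offset β ρ)))) (block-offset β ρ)))
      where
      vanish : ∀ ℓ → b * 4 ≤ ℓ → φ (onDiagonal a (row ℓ) ℓ) ≈ 0#
      vanish ℓ b*4≤ℓ =
        trans (reflexive (≡.cong (φ ∘ Maybe.map (entry a (row ℓ))) (block-beyond b*4≤ℓ))) φ-nothing

    ∑-row : ∀ a i → ∑′ n (λ j → φ (arrays a i j)) ≈
                    ∑′ b (λ β → ∑′ 4 (λ ρ → φ (just (entry a i (β , ρ)))))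
    ∑-row a i = trans (∑′-permute n (φ ∘ arrays a i) (rowPermutation i))
      (trans (∑′-cong n (λ ℓ → reflexive (≡.cong φ (arrays-+ₙ a i (toℕ<n ℓ)))))
             (∑-diagonals a (λ _ → i)))

    ∑-column : ∀ a j → ∑′ n (λ i → φ (arrays a i j)) ≈
               ∑′ b (λ β → ∑′ 4 (λ ρ → φ (just (entry a (j -ₙ offset β ρ) (β , ρ)))))
    ∑-column a j = trans (∑′-permute n (λ i → φ (arrays a i j)) (columnPermutation j))
      (trans (∑′-cong n (λ ℓ → reflexive (≡.cong φ (arrays--ₙ a j (toℕ<n ℓ)))))
             (∑-diagonals a (j -ₙ_)))

  open AbelianGroup G hiding (Carrier)

  module GroupSums = LineSums commutativeMonoid (val G) refl
  module Counts = LineSums ℕₚ.+-0-commutativeMonoid filled ≡.refl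

  rowCount : ∀ a i → countFilled n (arrays a i) ≡ 4 * b
  rowCount a i = begin
    countFilled n (arrays a i)                    ≡⟨ countFilled≡∑ n (arrays a i) ⟩
    ∑ _+_ 0 n (filled ∘ arrays a i)               ≡⟨ Counts.∑-row a i ⟩
    ∑ _+_ 0 b (λ _ → 4)                           ≡⟨ ∑-const b 4 ⟩
    b * 4                                         ≡⟨ ℕₚ.*-comm b 4 ⟩
    4 * b                                         ∎
    where open ≡.≡-Reasoning

  columnCount : ∀ a j → countFilled n (λ i → arrays a i j) ≡ 4 * b
  columnCount a j = begin
    countFilled n (λ i → arrays a i j)            ≡⟨ countFilled≡∑ n (λ i → arrays a i j) ⟩
    ∑ _+_ 0 n (λ i → filled (arrays a i j))       ≡⟨ Counts.∑-column a j ⟩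
    ∑ _+_ 0 b (λ _ → 4)                           ≡⟨ ∑-const b 4 ⟩
    b * 4                                         ≡⟨ ℕₚ.*-comm b 4 ⟩
    4 * b                                         ∎
    where open ≡.≡-Reasoning

  open Sums commutativeMonoid using (∑′; ∑′-cong)
  open import Algebra.Solver.CommutativeMonoid commutativeMonoid using (solve; _⊕_; _⊜_)

  ∑₄-pairs : ∀ w x y z → w ∙ (x ∙ (y ∙ (z ∙ ε))) ≈ (w ∙ x) ∙ (y ∙ z)
  ∑₄-pairs w x y z = trans (∙-congˡ (∙-congˡ (∙-congˡ (identityʳ z))))
    (solve 4 (λ w x y z → w ⊕ (x ⊕ (y ⊕ z)) ⊜ (w ⊕ x) ⊕ (y ⊕ z)) refl w x y z)

  ∑₄-crossPairs : ∀ w x y z → w ∙ (x ∙ (y ∙ (z ∙ ε))) ≈ (w ∙ y) ∙ (x ∙ z)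
  ∑₄-crossPairs w x y z = trans (∙-congˡ (∙-congˡ (∙-congˡ (identityʳ z))))
    (solve 4 (λ w x y z → w ⊕ (x ⊕ (y ⊕ z)) ⊜ (w ⊕ y) ⊕ (x ⊕ z)) refl w x y z)

  rowSum : ∀ a i → ∑′ n (val G ∘ arrays a i) ≈ ∑′ b (λ _ → rowPair ∙ rowPair)
  rowSum a i = trans (GroupSums.∑-row a i) (∑′-cong b λ β → trans (∑₄-pairs _ _ _ _)
    (∙-cong (sum₀₁ (quadrupleIndex a β (i -ₙ 2))) (sum₂₃ (quadrupleIndex a β i))))

  -ₙ-offset-2 : ∀ j β {ρ ρ'} → toℕ ρ + 2 ≡ toℕ ρ' → j -ₙ offset β ρ -ₙ 2 ≡ j -ₙ offset β ρ'
  -ₙ-offset-2 j β {ρ} {ρ'} ρ+2≡ρ' =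
    ≡.trans (-ₙ--ₙ j {offset β ρ} {2} (≡.subst (_≤ n) (≡.sym shift) (ℕₚ.<⇒≤ (offset<n β ρ'))))
            (≡.cong (j -ₙ_) shift)
    where
    shift : offset β ρ + 2 ≡ offset β ρ'
    shift = ≡.trans (ℕₚ.+-assoc (toℕ β * 4) (toℕ ρ) 2) (≡.cong (toℕ β * 4 +_) ρ+2≡ρ')

  columnSum : ∀ a j → ∑′ n (λ i → val G (arrays a i j)) ≈ ∑′ b (λ _ → colPair ∙ colPair)
  columnSum a j = trans (GroupSums.∑-column a j) (∑′-cong b λ β → trans (∑₄-crossPairs _ _ _ _)
    (∙-cong (trans (∙-congʳ (shifted β 0F 2F ≡.refl)) (sum₀₂ _))
            (trans (∙-congʳ (shifted β 1F 3F ≡.refl)) (sum₁₃ _))))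
    where
    shifted : ∀ β ρ ρ' → toℕ ρ + 2 ≡ toℕ ρ' →
              quadruple (quadrupleIndex a β (j -ₙ offset β ρ -ₙ 2)) ρ ≈
              quadruple (quadrupleIndex a β (j -ₙ offset β ρ')) ρ
    shifted β ρ ρ' ρ+2≡ρ' =
      reflexive (≡.cong (λ x → quadruple (quadrupleIndex a β x) ρ) (-ₙ-offset-2 j β ρ+2≡ρ'))

  rowOf : Fin n → Fin 4 → Fin n
  rowOf x 0F = x +ₙ 2
  rowOf x 1F = x +ₙ 2
  rowOf x 2F = x
  rowOf x 3F = x

  base-rowOf : 2 ≤ n → ∀ x ρ → base (rowOf x ρ) ρ ≡ x
  base-rowOf 2≤n x 0F = +ₙ--ₙ x 2≤n
  base-rowOf 2≤n x 1F = +ₙ--ₙ x 2≤n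
  base-rowOf 2≤n x 2F = ≡.refl
  base-rowOf 2≤n x 3F = ≡.refl

  base-injective : ∀ ρ {i i'} → base i ρ ≡ base i' ρ → i ≡ i'
  base-injective 0F = +ₙ-cancelʳ (ℕₚ.m∸n≤m n 2)
  base-injective 1F = +ₙ-cancelʳ (ℕₚ.m∸n≤m n 2)
  base-injective 2F = id
  base-injective 3F = id

  arrays-offset : ∀ a i β ρ → arrays a i (i +ₙ offset β ρ) ≡ just (entry a i (β , ρ))
  arrays-offset a i β ρ = ≡.trans (arrays-+ₙ a i (offset<n β ρ)) (≡.cong (Maybe.map _) (block-offset β ρ))

  arrays-rowOf : ∀ a β y ρ →
                 arrays a (rowOf y ρ) (rowOf y ρ +ₙ offset β ρ) ≡ just (quadruple (quadrupleIndex a β y) ρ)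
  arrays-rowOf a β y ρ = ≡.trans (arrays-offset a (rowOf y ρ) β ρ)
    (≡.cong (λ x → just (quadruple (quadrupleIndex a β x) ρ)) (base-rowOf 2≤n y ρ))
    where
    2≤n : 2 ≤ n
    2≤n = ℕₚ.≤-trans (ℕₚ.m≤n+m 2 (toℕ β * 4)) (ℕₚ.<⇒≤ (offset<n β 2F))

  appears : ∀ x → ∃[ a ] ∃[ i ] ∃[ j ] Σ Γ λ y → (arrays a i j ≡ just y) × (y ≈ x)
  appears x with quadruple-surjective x
  ... | r , ρ , r≈x with combine-surjective {k} {b * n} r
  ... | a , r′ , ≡.refl with combine-surjective {b} {n} r′
  ... | β , y , ≡.refl = a , rowOf y ρ , rowOf y ρ +ₙ offset β ρ , _ , arrays-rowOf a β y ρ , r≈x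

  onDiagonal≡just : ∀ a i ℓ {x} → onDiagonal a i ℓ ≡ just x →
                    ∃[ β ] ∃[ ρ ] (ℓ ≡ offset β ρ × entry a i (β , ρ) ≡ x)
  onDiagonal≡just a i ℓ eq with block ℓ in block≡
  onDiagonal≡just a i ℓ ≡.refl | just (β , ρ) = β , ρ , block≡just⇒offset ℓ block≡ , ≡.refl

  unique : ∀ a i j a' i' j' x y → arrays a i j ≡ just x → arrays a' i' j' ≡ just y →
           x ≈ y → (a ≡ a') × (i ≡ i') × (j ≡ j')
  unique a i j a' i' j' x y eq eq' x≈y
    with β , ρ , ℓ≡ , ≡.refl ← onDiagonal≡just a i _ eq
       | β' , ρ' , ℓ≡' , ≡.refl ← onDiagonal≡just a' i' _ eq'
    with r≡r' , ≡.refl ← quadruple-injective _ ρ _ ρ' x≈y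
    with ≡.refl , r₂≡r₂' ← combine-injective a _ a' _ r≡r'
    with ≡.refl , base≡ ← combine-injective β _ β' _ r₂≡r₂'
    with ≡.refl ← base-injective ρ base≡
    = ≡.refl , ≡.refl , (begin
      j                      ≡⟨ +ₙ-⊖ i j ⟨
      i +ₙ toℕ (j ⊖ i)       ≡⟨ ≡.cong (i +ₙ_) (diagIndex≡toℕ-⊖ i j) ⟨
      i +ₙ diagIndex G i j   ≡⟨ ≡.cong (i +ₙ_) (≡.trans ℓ≡ (≡.sym ℓ≡')) ⟩
      i +ₙ diagIndex G i j'  ≡⟨ ≡.cong (i +ₙ_) (diagIndex≡toℕ-⊖ i j') ⟩
      i +ₙ toℕ (j' ⊖ i)      ≡⟨ +ₙ-⊖ i j' ⟩
      j'                     ∎)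
    where open ≡.≡-Reasoning

  isDiagonal : ∀ a i j → Is-just (arrays a i j) ⇔ InDiagonals G Fin.zero (4 * b) i j
  isDiagonal a i j = mk⇔ to from
    where
    d = diagIndex G i j
    d<n : d < n
    d<n = ≡.subst (_< n) (≡.sym (diagIndex≡toℕ-⊖ i j)) (toℕ<n (j ⊖ i))
    to : Is-just (arrays a i j) → InDiagonals G Fin.zero (4 * b) i j
    to isJust with block d in block≡
    to (just _) | just (β , ρ) = d , d<4b , ≡.sym (m<n⇒m%n≡m d<n)
      where
      d<4b : d < 4 * b
      d<4b = ≡.subst₂ _<_ (≡.sym (block≡just⇒offset d block≡)) (ℕₚ.*-comm b 4) (offset< β ρ)
    from : InDiagonals G Fin.zero (4 * b) i j → Is-just (arrays a i j)
    from (r , r<4b , d≡r%n) with block d | block-within d<b*4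
      where
      d≡r : d ≡ r
      d≡r = ≡.trans d≡r%n (m<n⇒m%n≡m (ℕₚ.<-≤-trans r<4b (≡.subst (_≤ n) (ℕₚ.*-comm b 4) b*4≤n)))
      d<b*4 : d < b * 4
      d<b*4 = ≡.subst₂ _<_ (≡.sym d≡r) (ℕₚ.*-comm 4 b) r<4b
    ... | just _ | _ = just tt

  diagonalMRS : DiagonalMRS G n (4 * b) k
  diagonalMRS = record
    { arrays = arrays
    ; isMRS = record
      { appears  = appears
      ; unique   = unique
      ; rowCount = rowCount
      ; colCount = columnCount
      ; ω        = ∑′ b (λ _ → rowPair ∙ rowPair)
      ; δ        = ∑′ b (λ _ → colPair ∙ colPair)
      ; rowSum   = rowSum
      ; colSum   = columnSum
      }
    ; diagonal = λ a → Fin.zero , isDiagonal a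
    }

proposition5p8 : ∀ {c ℓ : Level} (b n k : ℕ) → 1 ≤ b → 4 * b ≤ n → 1 ≤ k →
    (G : AbelianGroup c ℓ) → HasOrder G (4 * n * b * k) →
    DiagonalMRS G n (4 * b) k
proposition5p8 _ zero     _ (s≤s z≤n) ()
proposition5p8 b (suc n') k _         4b≤n _ G order =
  Construction.diagonalMRS G b n' k (≡.subst (_≤ suc n') (ℕₚ.*-comm 4 b) 4b≤n)
    (quadruplePartition (kleinPair (divides M N≡M*4)) M N≡M*4)
  where
  open FiniteAbelianGroup G order
  M = k * (b * suc n')
  N≡M*4 : 4 * suc n' * b * k ≡ M * 4
  N≡M*4 = solve 3 (λ n b k → con 4 :* n :* b :* k := k :* (b :* n) :* con 4) ≡.refl (suc n') b k
    where open +-*-Solver
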